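{- Let $(A,f)$ be a finite closure algebra such that $f(a)\cdot f(b)\neq 0$ for all non-closed atoms $a,b\in A$. Then $f(a)\cdot f(b)\neq 0$ for all non-closed elements $a,b\in A$.
   Context: A closure algebra is a Boolean algebra with a map $f$ satisfying $f(0)=0$, $f(a+b)=f(a)+f(b)$, $a\le f(a)$, $f(f(a))\le f(a)$; an element $a$ is closed if $f(a)=a$. -}

module Defs where

open import Level using (Level; _⊔_) renaming (suc to lsuc)
open import Algebra.Lattice.Bundles using (BooleanAlgebra)
open import Data.Nat using (ℕ)
open import Data.Fin using (Fin)
open import Data.Product using (Σ; ∃)
open import Data.Sum using (_⊎_)
open import Relation.Nullary using (Dec) renaming (¬_ to Not)
open import Data.Product using (_×_)

-- Here + is join (∨), · is meet (∧), 0 is ⊥,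
-- and a ≤ b means a ∧ b ≈ a.
record ClosureAlgebra (c ℓ : Level) : Set (lsuc (c ⊔ ℓ)) where
  field
    boolAlg : BooleanAlgebra c ℓ
  open BooleanAlgebra boolAlg public renaming (¬_ to compl)
  _≤_ : Carrier → Carrier → Set ℓ
  a ≤ b = (a ∧ b) ≈ a
  field
    f        : Carrier → Carrier
    f-cong   : ∀ {a b} → a ≈ b → f a ≈ f b
    f-zero   : f ⊥ ≈ ⊥
    f-join   : ∀ a b → f (a ∨ b) ≈ (f a ∨ f b)
    f-infl   : ∀ a → a ≤ f a
    f-idem   : ∀ a → f (f a) ≤ f a

  Closed : Carrier → Set ℓ
  Closed a = f a ≈ a

  Atom : Carrier → Set (c ⊔ ℓ)
  Atom a = Not (a ≈ ⊥) × (∀ b → b ≤ a → (b ≈ ⊥) ⊎ (b ≈ a))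

IsFinite : ∀ {c ℓ} → ClosureAlgebra c ℓ → Set (c ⊔ ℓ)
IsFinite A = ((a b : Carrier) → Dec (a ≈ b)) ×
             (Σ ℕ λ n → Σ (Fin n → Carrier) λ e → ∀ a → ∃ λ i → e i ≈ a)
  where open ClosureAlgebra A

{-# OPTIONS --safe #-}
-- An element that is not closed lies above a non-closed atom: if a is not
-- an atom, pick 0 < b < a; then a = b + a·¬b, and as closed elements are
-- closed under +, one of the two strictly smaller parts b, a·¬b is not
-- closed.  Finiteness makes the strict order well-founded, so this descent
-- ends in a non-closed atom.  Given non-closed a, b, take non-closed atoms
-- x ≤ a and y ≤ b; then f x · f y ≤ f a · f b by monotonicity of f, so
-- f a · f b = 0 would force f x · f y = 0.
module Submission where

open import Defs
open import Level using (_⊔_)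
open import Relation.Nullary using (Dec; yes; no) renaming (¬_ to Not)
open import Relation.Nullary.Decidable using (map′; _×-dec_; ¬?)
open import Relation.Unary using (Pred; Decidable)
open import Relation.Binary using (Rel; Setoid; Poset; IsPartialOrder; IsStrictPartialOrder; _Respects_)
import Relation.Binary.Construct.On as On
import Relation.Binary.Properties.Poset as PosetProperties
open import Relation.Binary.Lattice using (MeetSemilattice)
import Relation.Binary.Lattice.Properties.MeetSemilattice as MeetSemilatticeProperties
open import Data.Nat using (ℕ)
open import Data.Fin using (Fin)
open import Data.Fin.Induction using (spo-wellFounded)
open import Data.Fin.Properties using (any?)
open import Data.Product using (∃; _,_; _×_)
open import Data.Sum using (_⊎_; inj₁; inj₂)
open import Data.Empty using (⊥-elim)
open import Function using (_on_; case_of_)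
open import Induction.WellFounded using (Acc; acc; WellFounded; Acc-resp-≈)
import Algebra.Lattice.Properties.BooleanAlgebra as BooleanAlgebraProperties
import Relation.Binary.Reasoning.Setoid as SetoidReasoning

module FinitelyEnumerated {a ℓ} (S : Setoid a ℓ) {n : ℕ}
  (e : Fin n → Setoid.Carrier S) (surj : ∀ x → ∃ λ i → Setoid._≈_ S (e i) x) where

  open Setoid S

  finite-∃? : ∀ {p} {P : Pred Carrier p} → P Respects _≈_ → Decidable P → Dec (∃ P)
  finite-∃? {P = P} resp P? = map′ (λ { (i , p) → e i , p }) from (any? (λ i → P? (e i)))
    where
    from : ∃ P → ∃ λ i → P (e i)
    from (x , px) with surj x
    ... | i , eᵢ≈x = i , resp (sym eᵢ≈x) px

  finite-spo-wellFounded : ∀ {r} {_<_ : Rel Carrier r} →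
                           IsStrictPartialOrder _≈_ _<_ → WellFounded _<_
  finite-spo-wellFounded {_<_ = _<_} spo x with surj x
  ... | i , eᵢ≈x = Acc-resp-≈ sym <-respʳ-≈ eᵢ≈x
                     (enumerated-accessible (spo-wellFounded (On.isStrictPartialOrder e spo) i))
    where
    open IsStrictPartialOrder spo using (<-respˡ-≈; <-respʳ-≈)
    enumerated-accessible : ∀ {i} → Acc (_<_ on e) i → Acc _<_ (e i)
    enumerated-accessible (acc rs) = acc λ {y} y<eᵢ → let j , eⱼ≈y = surj y in
      Acc-resp-≈ sym <-respʳ-≈ eⱼ≈y (enumerated-accessible (rs (<-respˡ-≈ (sym eⱼ≈y) y<eᵢ)))

module ClosureAlgebraProperties {c ℓ} (A : ClosureAlgebra c ℓ) where

  open ClosureAlgebra A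
  open BooleanAlgebraProperties boolAlg
    using (poset; ∧-orderTheoreticMeetSemilattice; ∧-zeroʳ; ∧-identityʳ)
  open SetoidReasoning setoid
  open FinitelyEnumerated using (finite-∃?; finite-spo-wellFounded)
  private
    module ⊑ = Poset poset
    module MeetOrder = MeetSemilattice ∧-orderTheoreticMeetSemilattice
    module Meet = MeetSemilatticeProperties ∧-orderTheoreticMeetSemilattice

  -- The library's natural order is x ≈ x ∧ y; the order of A is the same with
  -- the equation flipped, so its properties transfer by sym.
  ≤-isPartialOrder : IsPartialOrder _≈_ _≤_
  ≤-isPartialOrder = record
    { isPreorder = record
      { isEquivalence = isEquivalence
      ; reflexive     = λ x≈y → sym (⊑.reflexive x≈y)
      ; trans         = λ x≤y y≤z → sym (⊑.trans (sym x≤y) (sym y≤z))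
      }
    ; antisym = λ x≤y y≤x → ⊑.antisym (sym x≤y) (sym y≤x)
    }

  ≤-poset : Poset c ℓ ℓ
  ≤-poset = record { isPartialOrder = ≤-isPartialOrder }

  open PosetProperties ≤-poset public
    using (_<_; <-isStrictPartialOrder; ≤∧≉⇒<; <-respˡ-≈)
  open Poset ≤-poset public using (≤-respʳ-≈)
    renaming (refl to ≤-refl; trans to ≤-trans)

  x∧y≤x : ∀ x y → (x ∧ y) ≤ x
  x∧y≤x x y = sym (MeetOrder.x∧y≤x x y)

  ∧-mono-≤ : ∀ {x y u v} → x ≤ u → y ≤ v → (x ∧ y) ≤ (u ∧ v)
  ∧-mono-≤ x≤u y≤v = sym (Meet.∧-monotonic (sym x≤u) (sym y≤v))

  x≤⊥⇒x≈⊥ : ∀ {x} → x ≤ ⊥ → x ≈ ⊥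
  x≤⊥⇒x≈⊥ {x} x≤⊥ = trans (sym x≤⊥) (∧-zeroʳ x)

  x≤y⇒x∨y≈y : ∀ {x y} → x ≤ y → (x ∨ y) ≈ y
  x≤y⇒x∨y≈y {x} {y} x≤y = begin
    x ∨ y       ≈⟨ ∨-comm x y ⟩
    y ∨ x       ≈⟨ ∨-cong refl (sym (trans (∧-comm y x) x≤y)) ⟩
    y ∨ (y ∧ x) ≈⟨ ∨-absorbs-∧ y x ⟩
    y           ∎

  x≤y⇒y≈x∨y∧¬x : ∀ {x y} → x ≤ y → y ≈ (x ∨ (y ∧ compl x))
  x≤y⇒y≈x∨y∧¬x {x} {y} x≤y = sym (begin
    x ∨ (y ∧ compl x)       ≈⟨ ∨-distribˡ-∧ x y (compl x) ⟩
    (x ∨ y) ∧ (x ∨ compl x) ≈⟨ ∧-cong (x≤y⇒x∨y≈y x≤y) (∨-complementʳ x) ⟩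
    y ∧ ⊤                   ≈⟨ ∧-identityʳ y ⟩
    y                       ∎)

  y∧¬x<y : ∀ {x y} → x ≤ y → Not (x ≈ ⊥) → (y ∧ compl x) < y
  y∧¬x<y {x} {y} x≤y x≉⊥ = ≤∧≉⇒< (x∧y≤x y (compl x)) λ y∧¬x≈y → x≉⊥ (begin
    x                  ≈⟨ sym x≤y ⟩
    x ∧ y              ≈⟨ ∧-cong refl (sym y∧¬x≈y) ⟩
    x ∧ (y ∧ compl x)  ≈⟨ sym (∧-assoc x y (compl x)) ⟩
    (x ∧ y) ∧ compl x  ≈⟨ ∧-cong x≤y refl ⟩
    x ∧ compl x        ≈⟨ ∧-complementʳ x ⟩
    ⊥                  ∎)

  f-mono : ∀ {x y} → x ≤ y → f x ≤ f y
  f-mono {x} {y} x≤y = begin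
    f x ∧ f y         ≈⟨ ∧-cong refl (f-cong (sym (x≤y⇒x∨y≈y x≤y))) ⟩
    f x ∧ f (x ∨ y)   ≈⟨ ∧-cong refl (f-join x y) ⟩
    f x ∧ (f x ∨ f y) ≈⟨ ∧-absorbs-∨ (f x) (f y) ⟩
    f x               ∎

  Closed-resp-≈ : ∀ {x y} → x ≈ y → Closed x → Closed y
  Closed-resp-≈ x≈y fx≈x = trans (f-cong (sym x≈y)) (trans fx≈x x≈y)

  Closed-∨ : ∀ {x y} → Closed x → Closed y → Closed (x ∨ y)
  Closed-∨ {x} {y} fx≈x fy≈y = trans (f-join x y) (∨-cong fx≈x fy≈y)

  ¬Closed⇒≉⊥ : ∀ {x} → Not (Closed x) → Not (x ≈ ⊥)
  ¬Closed⇒≉⊥ x-open x≈⊥ = x-open (Closed-resp-≈ (sym x≈⊥) f-zero)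

  NonClosedAtomBelow : Carrier → Set (c ⊔ ℓ)
  NonClosedAtomBelow a = ∃ λ x → Atom x × Not (Closed x) × x ≤ a

  NonClosedAtomBelow-mono : ∀ {a b} → a ≤ b → NonClosedAtomBelow a → NonClosedAtomBelow b
  NonClosedAtomBelow-mono a≤b (x , x-atom , x-open , x≤a) = x , x-atom , x-open , ≤-trans x≤a a≤b

  atom⊎properPart : IsFinite A → ∀ {a} → Not (a ≈ ⊥) →
                    Atom a ⊎ ∃ λ b → Not (b ≈ ⊥) × b < a
  atom⊎properPart (_≟_ , _ , e , surj) {a} a≉⊥ =
    case finite-∃? setoid e surj ProperPart-resp ProperPart? of λ where
      (yes part)  → inj₂ part
      (no ¬part) → inj₁ (a≉⊥ , atomic ¬part)
    where
    ProperPart : Pred Carrier ℓ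
    ProperPart b = Not (b ≈ ⊥) × b < a

    ProperPart? : Decidable ProperPart
    ProperPart? b = ¬? (b ≟ ⊥) ×-dec ((b ∧ a) ≟ b ×-dec ¬? (b ≟ a))

    ProperPart-resp : ProperPart Respects _≈_
    ProperPart-resp b≈c (b≉⊥ , b<a) = (λ c≈⊥ → b≉⊥ (trans b≈c c≈⊥)) , <-respˡ-≈ b≈c b<a

    atomic : Not (∃ ProperPart) → ∀ b → b ≤ a → (b ≈ ⊥) ⊎ (b ≈ a)
    atomic ¬part b b≤a with b ≟ ⊥ | b ≟ a
    ... | yes b≈⊥ | _       = inj₁ b≈⊥
    ... | no _    | yes b≈a = inj₂ b≈a
    ... | no b≉⊥  | no b≉a  = ⊥-elim (¬part (b , b≉⊥ , b≤a , b≉a))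

  nonClosedAtomBelow : IsFinite A → ∀ a → Not (Closed a) → NonClosedAtomBelow a
  nonClosedAtomBelow fin@(_≟_ , _ , e , surj) a =
    descend a (finite-spo-wellFounded setoid e surj <-isStrictPartialOrder a)
    where
    descend : ∀ a → Acc _<_ a → Not (Closed a) → NonClosedAtomBelow a
    descend a (acc rs) a-open with atom⊎properPart fin (¬Closed⇒≉⊥ a-open)
    ... | inj₁ a-atom = a , a-atom , a-open , ≤-refl
    ... | inj₂ (b , b≉⊥ , b<a@(b≤a , _)) with f b ≟ b | f (a ∧ compl b) ≟ (a ∧ compl b)
    ...   | no b-open | _ = NonClosedAtomBelow-mono b≤a (descend b (rs b<a) b-open)
    ...   | yes b-closed | yes rest-closed = ⊥-elim (a-open
            (Closed-resp-≈ (sym (x≤y⇒y≈x∨y∧¬x b≤a)) (Closed-∨ b-closed rest-closed)))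
    ...   | yes _ | no rest-open = NonClosedAtomBelow-mono (x∧y≤x a (compl b))
            (descend (a ∧ compl b) (rs (y∧¬x<y b≤a b≉⊥)) rest-open)

mainTheorem16 : ∀ {c ℓ} (A : ClosureAlgebra c ℓ) → IsFinite A →
    (let open ClosureAlgebra A in
      ∀ a b → Atom a → Atom b → Not (Closed a) → Not (Closed b) → Not ((f a ∧ f b) ≈ ⊥)) →
    (let open ClosureAlgebra A in
      ∀ a b → Not (Closed a) → Not (Closed b) → Not ((f a ∧ f b) ≈ ⊥))
mainTheorem16 A fin atomsMeet a b a-open b-open fa∧fb≈⊥ =
  let x , x-atom , x-open , x≤a = nonClosedAtomBelow fin a a-open
      y , y-atom , y-open , y≤b = nonClosedAtomBelow fin b b-open
  in atomsMeet x y x-atom y-atom x-open y-open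
       (x≤⊥⇒x≈⊥ (≤-respʳ-≈ fa∧fb≈⊥ (∧-mono-≤ (f-mono x≤a) (f-mono y≤b))))
  where open ClosureAlgebra A; open ClosureAlgebraProperties A
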